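{- Let $E$ be a finite nonempty set and $\mathcal{F}$ a nonempty family of subsets of $E$. Then $\mathcal{F}$ satisfies the simultaneous exchange property $(\dagger)$ — for every $X,X'\in\mathcal{F}$ with $X\neq X'$ there exist distinct $x\in(X\setminus X')\cup\{\emptyset\}$ and $x'\in(X'\setminus X)\cup\{\emptyset\}$ such that $X-x+x'\in\mathcal{F}$ and $X'+x-x'\in\mathcal{F}$ — if and only if $\mathcal{F}$ is an M${}^\natural$-convex set (generalized matroid) on $E$.
   Context: Notation: for $X\subseteq E$ and $x\in E\setminus X$, $X+x=X\cup\{x\}$; for $x\in X$, $X-x=X\setminus\{x\}$. The symbol $\emptyset$ is also used as a formal element not in $E$, with $X+\emptyset=X-\emptyset=X$. A nonempty family $\mathcal{F}\subseteq 2^E$ is an M${}^\natural$-convex set (generalized matroid) if for all $X,Y\in\mathcal{F}$ and every $x\in X\setminus Y$ there exists $y\in(Y\setminus X)\cup\{\emptyset\}$ with $X-x+y\in\mathcal{F}$ and $Y+x-y\in\mathcal{F}$. -}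

module Defs where

open import Data.Nat using (ℕ)
open import Data.Fin using (Fin)
open import Data.Fin.Subset using (Subset; _∈_; _∉_; _-_; _∪_; ⁅_⁆)
open import Data.Maybe using (Maybe; just; nothing)
open import Data.Product using (_×_; Σ; ∃; _,_)
open import Relation.Binary.PropositionalEquality using (_≡_)
open import Relation.Nullary using (¬_)
open import Data.Unit using (⊤)

-- Ground set E = Fin n.  A family 𝓕 ⊆ 2^E is a predicate on Subset n.
-- An "element or the formal element ∅" is a Maybe (Fin n): nothing = ∅.

_⊕_ : ∀ {n} → Subset n → Maybe (Fin n) → Subset n
X ⊕ nothing = X
X ⊕ just x  = X ∪ ⁅ x ⁆

_⊖_ : ∀ {n} → Subset n → Maybe (Fin n) → Subset n
X ⊖ nothing = X
X ⊖ just x  = X - x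

infixl 6 _⊕_ _⊖_

_∈Diff∅_∖_ : ∀ {n} → Maybe (Fin n) → Subset n → Subset n → Set
nothing ∈Diff∅ X ∖ Y = ⊤
just x  ∈Diff∅ X ∖ Y = x ∈ X × x ∉ Y

IsMNatConvex : ∀ {n} → (Subset n → Set) → Set
IsMNatConvex {n} 𝓕 =
  (∃ λ X → 𝓕 X) ×
  (∀ X Y → 𝓕 X → 𝓕 Y → ∀ x → x ∈ X → x ∉ Y →
     Σ (Maybe (Fin n)) λ y → (y ∈Diff∅ Y ∖ X) ×
       𝓕 (X ⊖ just x ⊕ y) × 𝓕 (Y ⊕ just x ⊖ y))

SimultaneousExchange : ∀ {n} → (Subset n → Set) → Set
SimultaneousExchange {n} 𝓕 =
  ∀ X X' → 𝓕 X → 𝓕 X' → ¬ X ≡ X' →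
    Σ (Maybe (Fin n)) λ x → Σ (Maybe (Fin n)) λ x' →
      ¬ x ≡ x' × (x ∈Diff∅ X ∖ X') × (x' ∈Diff∅ X' ∖ X) ×
      𝓕 (X ⊖ x ⊕ x') × 𝓕 (X' ⊕ x ⊖ x')

{-# OPTIONS --safe #-}
module Submission where

open import Defs
open import Data.Bool using (true; false)
import Data.Bool as Bool
open import Data.Bool.Properties using (∨-zeroʳ; ∨-identityʳ; ¬-not)
open import Data.Empty using (⊥-elim)
open import Data.Fin using (Fin; zero; suc; _≟_)
open import Data.Fin.Subset using (Subset; _∈_; _∉_; _─_; _∪_; ⁅_⁆; ∣_∣; _⊆_; _⊂_)
open import Data.Fin.Subset.Properties
  using (p⊂q⇒∣p∣<∣q∣; p─q⊆p; ∪-assoc; ∪-comm; ∪-identityʳ; p─⊥≡p; p─x─y≡p─y─x;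
         x∈p∪q⁺; x∈p∪q⁻; x∈p∧x∉q⇒x∈p─q)
open import Data.Maybe using (Maybe; just; nothing)
open import Data.Maybe.Properties using (just-injective) renaming (≡-dec to ≡-dec-Maybe)
open import Data.Nat using (ℕ; suc; _<_)
open import Data.Nat.Properties using (<-≤-trans; ≤-pred; n<1+n)
open import Data.Product using (_×_; _,_; ∃; Σ; proj₁)
open import Data.Sum using (_⊎_; inj₁; inj₂; [_,_]′; swap)
open import Data.Vec using ([]; _∷_; lookup; _[_]≔_; _[_]=_; here; there)
open import Data.Vec.Properties
  using (≡-dec; []≔-commutes; []≔-idempotent; []≔-lookup; []≔-updates; []≔-minimal;
         []=-injective; []=⇒lookup; lookup⇒[]=; lookup∘update′)
open import Function using (_∘_; flip)
open import Function.Bundles using (_⇔_; mk⇔)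
open import Relation.Binary.PropositionalEquality
  using (_≡_; _≢_; refl; sym; trans; cong; cong₂; subst; module ≡-Reasoning)
open import Relation.Nullary using (yes; no)

-- The converse direction is immediate: two distinct members of 𝓕 differ in some element, and the
-- exchange axiom applied to that element is a simultaneous exchange.
--
-- For (†) ⇒ M♮-convexity, fix X, Y ∈ 𝓕 and x ∈ X ∖ Y and argue by induction on |X △ Y|.  Applying
-- (†) to X and Y gives X′ = X − a + b and Y′ = Y + a − b in 𝓕; if a = x we are done.  Otherwise
-- exchanging x between X and Y′ yields a partner y with X − x + y ∈ 𝓕 and Y + a − b + x − y ∈ 𝓕,
-- and returning a from the latter set to X (returning b, if a = ∅) shows that Y + x − y or
-- Y + x − b lies in 𝓕, or else Y + a ∈ 𝓕.  Symmetrically through X′, and a case analysis of the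
-- outcomes always finds a common partner; when Y + a and X − a are in 𝓕 one restarts with b = ∅.
-- Each auxiliary exchange is between X or Y and a set W in the interval [X ∩ Y, X ∪ Y]: such a
-- pair is strictly closer unless W is the other one of X and Y, and then the exchange supplied by
-- (†) is the required one.

private variable
  n : ℕ
  i e : Fin n
  u : Maybe (Fin n)
  P Q S X Y : Subset n

-- Adding and removing one element

⊕-update : ∀ (S : Subset n) e → S ⊕ just e ≡ S [ e ]≔ true
⊕-update (s ∷ S) zero    = cong₂ _∷_ (∨-zeroʳ s) (∪-identityʳ S)
⊕-update (s ∷ S) (suc e) = cong₂ _∷_ (∨-identityʳ s) (⊕-update S e)

⊖-update : ∀ (S : Subset n) e → S ⊖ just e ≡ S [ e ]≔ false
⊖-update (s ∷ S) zero    = cong (false ∷_) (p─⊥≡p S)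
⊖-update (s ∷ S) (suc e) = cong (s ∷_) (⊖-update S e)

[]≔-minimal⁻ : ∀ {xs : Subset n} {b c} → i ≢ e → (xs [ e ]≔ c) [ i ]= b → xs [ i ]= b
[]≔-minimal⁻ {i = i} {xs = xs} {c = c} i≢e h =
  lookup⇒[]= i xs (trans (sym (lookup∘update′ i≢e xs c)) ([]=⇒lookup h))

∈-⊕-self : ∀ (S : Subset n) e → e ∈ S ⊕ just e
∈-⊕-self S e = subst (e ∈_) (sym (⊕-update S e)) ([]≔-updates S e)

∉-⊖-self : ∀ (S : Subset n) e → e ∉ S ⊖ just e
∉-⊖-self S e h with []=-injective (subst (e ∈_) (⊖-update S e) h) ([]≔-updates S e)
... | ()

∈-⊕ : i ∈ S → i ∈ S ⊕ u
∈-⊕ {u = nothing} i∈S = i∈S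
∈-⊕ {i = i} {S} {just e} i∈S with i ≟ e
... | yes refl = ∈-⊕-self S i
... | no i≢e   = subst (i ∈_) (sym (⊕-update S e)) ([]≔-minimal S i e i≢e i∈S)

∈-⊖ : i ∈ S → u ≢ just i → i ∈ S ⊖ u
∈-⊖ {u = nothing} i∈S _ = i∈S
∈-⊖ {i = i} {S} {just e} i∈S e≢i =
  subst (i ∈_) (sym (⊖-update S e)) ([]≔-minimal S i e (e≢i ∘ cong just ∘ sym) i∈S)

∈-⊕⁻ : i ∈ S ⊕ u → u ≡ just i ⊎ i ∈ S
∈-⊕⁻ {u = nothing} h = inj₂ h
∈-⊕⁻ {i = i} {S} {just e} h with i ≟ e
... | yes refl = inj₁ refl
... | no i≢e   = inj₂ ([]≔-minimal⁻ i≢e (subst (i ∈_) (⊕-update S e) h))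

∈-⊕-≢⁻ : i ∈ S ⊕ u → u ≢ just i → i ∈ S
∈-⊕-≢⁻ {u = u} h u≢i = [ ⊥-elim ∘ u≢i , (λ i∈S → i∈S) ]′ (∈-⊕⁻ {u = u} h)

∈-⊖⁻ : i ∈ S ⊖ u → i ∈ S
∈-⊖⁻ {u = nothing} h = h
∈-⊖⁻ {i = i} {S} {just e} h with i ≟ e
... | yes refl = ⊥-elim (∉-⊖-self S i h)
... | no i≢e   = []≔-minimal⁻ i≢e (subst (i ∈_) (⊖-update S e) h)

∉-⊕ : i ∉ S → u ≢ just i → i ∉ S ⊕ u
∉-⊕ {u = u} i∉S u≢i = [ u≢i , i∉S ]′ ∘ ∈-⊕⁻ {u = u}

∉-⊖ : i ∉ S → i ∉ S ⊖ u
∉-⊖ {u = u} i∉S = i∉S ∘ ∈-⊖⁻ {u = u}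

⊕-comm : ∀ (S : Subset n) u v → S ⊕ u ⊕ v ≡ S ⊕ v ⊕ u
⊕-comm S nothing  v        = refl
⊕-comm S (just e) nothing  = refl
⊕-comm S (just e) (just f) = begin
  S ⊕ just e ⊕ just f ≡⟨ ∪-assoc S ⁅ e ⁆ ⁅ f ⁆ ⟩
  S ∪ (⁅ e ⁆ ∪ ⁅ f ⁆) ≡⟨ cong (S ∪_) (∪-comm ⁅ e ⁆ ⁅ f ⁆) ⟩
  S ∪ (⁅ f ⁆ ∪ ⁅ e ⁆) ≡⟨ ∪-assoc S ⁅ f ⁆ ⁅ e ⁆ ⟨
  S ⊕ just f ⊕ just e ∎
  where open ≡-Reasoning

⊖-comm : ∀ (S : Subset n) u v → S ⊖ u ⊖ v ≡ S ⊖ v ⊖ u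
⊖-comm S nothing  v        = refl
⊖-comm S (just e) nothing  = refl
⊖-comm S (just e) (just f) = p─x─y≡p─y─x S e f

⊖⊕-comm : ∀ (S : Subset n) u {e} → u ≢ just e → S ⊖ u ⊕ just e ≡ S ⊕ just e ⊖ u
⊖⊕-comm S nothing      _   = refl
⊖⊕-comm S (just f) {e} f≢e = begin
  S ⊖ just f ⊕ just e        ≡⟨ ⊕-update _ e ⟩
  (S ⊖ just f) [ e ]≔ true   ≡⟨ cong (_[ e ]≔ true) (⊖-update S f) ⟩
  S [ f ]≔ false [ e ]≔ true ≡⟨ []≔-commutes S f e (f≢e ∘ cong just) ⟩
  S [ e ]≔ true [ f ]≔ false ≡⟨ cong (_[ f ]≔ false) (⊕-update S e) ⟨
  (S ⊕ just e) [ f ]≔ false  ≡⟨ ⊖-update _ f ⟨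
  S ⊕ just e ⊖ just f        ∎
  where open ≡-Reasoning

⊕⊖-comm : ∀ (S : Subset n) u {e} → u ≢ just e → S ⊕ u ⊖ just e ≡ S ⊖ just e ⊕ u
⊕⊖-comm S nothing  _   = refl
⊕⊖-comm S (just f) f≢e = sym (⊖⊕-comm S (just _) (f≢e ∘ sym))

∈⇒⊖⊕≡ : e ∈ S → S ⊖ just e ⊕ just e ≡ S
∈⇒⊖⊕≡ {e = e} {S} e∈S = begin
  S ⊖ just e ⊕ just e        ≡⟨ ⊕-update _ e ⟩
  (S ⊖ just e) [ e ]≔ true   ≡⟨ cong (_[ e ]≔ true) (⊖-update S e) ⟩
  S [ e ]≔ false [ e ]≔ true ≡⟨ []≔-idempotent S e ⟩
  S [ e ]≔ true              ≡⟨ cong (S [ e ]≔_) ([]=⇒lookup e∈S) ⟨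
  S [ e ]≔ lookup S e        ≡⟨ []≔-lookup S e ⟩
  S                          ∎
  where open ≡-Reasoning

∉⇒⊕⊖≡ : e ∉ S → S ⊕ just e ⊖ just e ≡ S
∉⇒⊕⊖≡ {e = e} {S} e∉S = begin
  S ⊕ just e ⊖ just e        ≡⟨ ⊖-update _ e ⟩
  (S ⊕ just e) [ e ]≔ false  ≡⟨ cong (_[ e ]≔ false) (⊕-update S e) ⟩
  S [ e ]≔ true [ e ]≔ false ≡⟨ []≔-idempotent S e ⟩
  S [ e ]≔ false             ≡⟨ cong (S [ e ]≔_) (¬-not (e∉S ∘ lookup⇒[]= e S)) ⟨
  S [ e ]≔ lookup S e        ≡⟨ []≔-lookup S e ⟩
  S                          ∎
  where open ≡-Reasoning

reinsert : ∀ (S : Subset n) u v → e ∈ S → v ≢ just e → S ⊖ just e ⊕ u ⊖ v ⊕ just e ≡ S ⊕ u ⊖ v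
reinsert {e = e} S u v e∈S v≢e = begin
  S ⊖ just e ⊕ u ⊖ v ⊕ just e ≡⟨ ⊖⊕-comm (S ⊖ just e ⊕ u) v v≢e ⟩
  S ⊖ just e ⊕ u ⊕ just e ⊖ v ≡⟨ cong (_⊖ v) (⊕-comm (S ⊖ just e) u (just e)) ⟩
  S ⊖ just e ⊕ just e ⊕ u ⊖ v ≡⟨ cong (λ T → T ⊕ u ⊖ v) (∈⇒⊖⊕≡ e∈S) ⟩
  S ⊕ u ⊖ v                   ∎
  where open ≡-Reasoning

redelete : ∀ (S : Subset n) u v → e ∉ S → v ≢ just e → S ⊕ just e ⊖ u ⊕ v ⊖ just e ≡ S ⊖ u ⊕ v
redelete {e = e} S u v e∉S v≢e = begin
  S ⊕ just e ⊖ u ⊕ v ⊖ just e ≡⟨ ⊕⊖-comm (S ⊕ just e ⊖ u) v v≢e ⟩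
  S ⊕ just e ⊖ u ⊖ just e ⊕ v ≡⟨ cong (_⊕ v) (⊖-comm (S ⊕ just e) u (just e)) ⟩
  S ⊕ just e ⊖ just e ⊖ u ⊕ v ≡⟨ cong (λ T → T ⊖ u ⊕ v) (∉⇒⊕⊖≡ e∉S) ⟩
  S ⊖ u ⊕ v                   ∎
  where open ≡-Reasoning

∈∉⇒≢ : i ∈ P → i ∉ Q → P ≢ Q
∈∉⇒≢ i∈P i∉Q refl = i∉Q i∈P

∈Diff∅⇒≢ˡ : u ∈Diff∅ P ∖ Q → e ∉ P → u ≢ just e
∈Diff∅⇒≢ˡ {u = just i} (i∈P , _) e∉P refl = e∉P i∈P

∈Diff∅⇒≢ʳ : u ∈Diff∅ P ∖ Q → e ∈ Q → u ≢ just e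
∈Diff∅⇒≢ʳ {u = just i} (_ , i∉Q) e∈Q refl = i∉Q e∈Q

∈Diff∅-⊖⁻ : ∀ v → u ∈Diff∅ (P ⊖ v) ∖ Q → u ∈Diff∅ P ∖ Q
∈Diff∅-⊖⁻ {u = nothing} v _           = _
∈Diff∅-⊖⁻ {u = just e}  v (e∈ , e∉Q) = ∈-⊖⁻ {u = v} e∈ , e∉Q

∈Diff∅-⊕⁻ : ∀ v → u ∈Diff∅ P ∖ (Q ⊕ v) → u ∈Diff∅ P ∖ Q
∈Diff∅-⊕⁻ {u = nothing} v _           = _
∈Diff∅-⊕⁻ {u = just e}  v (e∈P , e∉) = e∈P , e∉ ∘ ∈-⊕ {u = v}

-- The interval between two sets

_△_ : Subset n → Subset n → Subset n
P △ Q = (P ─ Q) ∪ (Q ─ P)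

△-comm : ∀ (P Q : Subset n) → P △ Q ≡ Q △ P
△-comm P Q = ∪-comm (P ─ Q) (Q ─ P)

x∈p─q⇒x∉q : ∀ (p q : Subset n) → i ∈ p ─ q → i ∉ q
x∈p─q⇒x∉q (_ ∷ p) (true  ∷ q) (there h) (there i∈q) = x∈p─q⇒x∉q p q h i∈q
x∈p─q⇒x∉q (_ ∷ p) (false ∷ q) (there h) (there i∈q) = x∈p─q⇒x∉q p q h i∈q

∈△⁺ˡ : i ∈ P → i ∉ Q → i ∈ P △ Q
∈△⁺ˡ i∈P i∉Q = x∈p∪q⁺ (inj₁ (x∈p∧x∉q⇒x∈p─q i∈P i∉Q))

∈△⁺ʳ : i ∈ Q → i ∉ P → i ∈ P △ Q
∈△⁺ʳ i∈Q i∉P = x∈p∪q⁺ (inj₂ (x∈p∧x∉q⇒x∈p─q i∈Q i∉P))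

∈△⁻ : ∀ (P Q : Subset n) → i ∈ P △ Q → i ∈ P × i ∉ Q ⊎ i ∈ Q × i ∉ P
∈△⁻ P Q h with x∈p∪q⁻ (P ─ Q) (Q ─ P) h
... | inj₁ h′ = inj₁ (p─q⊆p P Q h′ , x∈p─q⇒x∉q P Q h′)
... | inj₂ h′ = inj₂ (p─q⊆p Q P h′ , x∈p─q⇒x∉q Q P h′)

≢⇒∃∈△ : P ≢ Q → ∃ λ i → i ∈ P △ Q
≢⇒∃∈△ {P = []}        {[]}        P≢Q = ⊥-elim (P≢Q refl)
≢⇒∃∈△ {P = true ∷ P}  {false ∷ Q} _   = zero , here
≢⇒∃∈△ {P = false ∷ P} {true ∷ Q}  _   = zero , here
≢⇒∃∈△ {P = true ∷ P}  {true ∷ Q}  P≢Q with ≢⇒∃∈△ (P≢Q ∘ cong (true ∷_))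
... | i , i∈ = suc i , there i∈
≢⇒∃∈△ {P = false ∷ P} {false ∷ Q} P≢Q with ≢⇒∃∈△ (P≢Q ∘ cong (false ∷_))
... | i , i∈ = suc i , there i∈

Between : Subset n → Subset n → Subset n → Set
Between X Y S = (∀ {i} → i ∈ X → i ∈ Y → i ∈ S) × (∀ {i} → i ∈ S → i ∈ X ⊎ i ∈ Y)

between-sym : Between X Y S → Between Y X S
between-sym (common , bounded) = flip common , swap ∘ bounded

between-ˡ : Between X Y X
between-ˡ = (λ i∈X _ → i∈X) , inj₁

between-ʳ : Between X Y Y
between-ʳ = (λ _ i∈Y → i∈Y) , inj₂

Crossing : Subset n → Subset n → Maybe (Fin n) → Set
Crossing X Y u = u ∈Diff∅ X ∖ Y ⊎ u ∈Diff∅ Y ∖ X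

between-⊕ : Between X Y S → Crossing X Y u → Between X Y (S ⊕ u)
between-⊕ {u = nothing} S∈ _ = S∈
between-⊕ {S = S} {u = just e} (common , bounded) e∈ =
  (λ i∈X i∈Y → ∈-⊕ {S = S} (common i∈X i∈Y)) ,
  [ (λ { refl → [ inj₁ ∘ proj₁ , inj₂ ∘ proj₁ ]′ e∈ }) , bounded ]′ ∘ ∈-⊕⁻ {S = S}

between-⊖ : Between X Y S → Crossing X Y u → Between X Y (S ⊖ u)
between-⊖ {u = nothing} S∈ _ = S∈
between-⊖ {S = S} {u = just e} (common , bounded) e∈ =
  (λ i∈X i∈Y → ∈-⊖ (common i∈X i∈Y) λ { refl →
     [ (λ (_ , e∉Y) → e∉Y i∈Y) , (λ (_ , e∉X) → e∉X i∈X) ]′ e∈ }) ,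
  bounded ∘ ∈-⊖⁻ {S = S}

between-△-⊂ : Between X Y S → S ≢ X → S △ Y ⊂ X △ Y
between-△-⊂ {X = X} {Y} {S} (common , bounded) S≢X = △-⊆ , witness (≢⇒∃∈△ S≢X)
  where
  △-⊆ : S △ Y ⊆ X △ Y
  △-⊆ h with ∈△⁻ S Y h
  ... | inj₁ (i∈S , i∉Y) = ∈△⁺ˡ ([ (λ i∈X → i∈X) , (λ i∈Y → ⊥-elim (i∉Y i∈Y)) ]′ (bounded i∈S)) i∉Y
  ... | inj₂ (i∈Y , i∉S) = ∈△⁺ʳ i∈Y (λ i∈X → i∉S (common i∈X i∈Y))

  witness : ∃ (λ i → i ∈ S △ X) → ∃ λ i → i ∈ X △ Y × i ∉ S △ Y
  witness (i , h) with ∈△⁻ S X h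
  ... | inj₁ (i∈S , i∉X) =
    i , ∈△⁺ʳ i∈Y i∉X , [ (λ (_ , i∉Y) → i∉Y i∈Y) , (λ (_ , i∉S) → i∉S i∈S) ]′ ∘ ∈△⁻ S Y
    where i∈Y = [ (λ i∈X → ⊥-elim (i∉X i∈X)) , (λ i∈Y → i∈Y) ]′ (bounded i∈S)
  ... | inj₂ (i∈X , i∉S) =
    i , ∈△⁺ˡ i∈X i∉Y , [ (λ (i∈S , _) → i∉S i∈S) , (λ (i∈Y , _) → i∉Y i∈Y) ]′ ∘ ∈△⁻ S Y
    where i∉Y = λ i∈Y → i∉S (common i∈X i∈Y)

closer-to-Y : Between X Y S → S ≢ X → ∣ S △ Y ∣ < ∣ X △ Y ∣
closer-to-Y S∈ S≢X = p⊂q⇒∣p∣<∣q∣ (between-△-⊂ S∈ S≢X)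

closer-to-X : Between X Y S → S ≢ Y → ∣ S △ X ∣ < ∣ X △ Y ∣
closer-to-X {X = X} {Y} {S} S∈ S≢Y =
  subst (∣ S △ X ∣ <_) (cong ∣_∣ (△-comm Y X)) (closer-to-Y (between-sym S∈) S≢Y)

-- The exchange step

Exchange : (Subset n → Set) → Subset n → Subset n → Fin n → Set
Exchange {n} F P Q z =
  Σ (Maybe (Fin n)) λ y → (y ∈Diff∅ Q ∖ P) × F (P ⊖ just z ⊕ y) × F (Q ⊕ just z ⊖ y)

reverse-exchange : ∀ {F : Subset n → Set} {a b} → a ∈ X → a ∉ Y → b ∈ Y →
                   F (X ⊖ just a ⊕ just b) → F (Y ⊕ just a ⊖ just b) → Exchange F Y X b
reverse-exchange {F = F} {a = a} {b} a∈X a∉Y b∈Y FX′ FY′ =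
  just a , (a∈X , a∉Y) ,
  subst F (sym (⊖⊕-comm _ (just b) b≢a)) FY′ , subst F (sym (⊕⊖-comm _ (just b) b≢a)) FX′
  where
  b≢a : just b ≢ just a
  b≢a b≡a = a∉Y (subst (_∈ _) (just-injective b≡a) b∈Y)

module ExchangeStep {F : Subset n → Set} {X Y : Subset n} (FX : F X) (FY : F Y)
  (ih : ∀ {P Q} → F P → F Q → ∣ P △ Q ∣ < ∣ X △ Y ∣ → ∀ {z} → z ∈ P → z ∉ Q → Exchange F P Q z)
  where

  exchange-toward-Y : ∀ {W z} → F W → Between X Y W → (W ≡ X → Exchange F X Y z) →
                      z ∈ W → z ∉ Y → Exchange F W Y z
  exchange-toward-Y {W} FW W∈ fallback z∈W z∉Y with ≡-dec Bool._≟_ W X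
  ... | yes refl = fallback refl
  ... | no W≢X   = ih FW FY (closer-to-Y W∈ W≢X) z∈W z∉Y

  exchange-from-Y : ∀ {W z} → F W → Between X Y W → (W ≡ X → Exchange F Y X z) →
                    z ∈ Y → z ∉ W → Exchange F Y W z
  exchange-from-Y {W} FW W∈ fallback z∈Y z∉W with ≡-dec Bool._≟_ W X
  ... | yes refl = fallback refl
  ... | no W≢X   =
    ih FY FW (subst (_< ∣ X △ Y ∣) (cong ∣_∣ (△-comm W Y)) (closer-to-Y W∈ W≢X)) z∈Y z∉W

  exchange-toward-X : ∀ {W z} → F W → Between X Y W → (W ≡ Y → Exchange F Y X z) →
                      z ∈ W → z ∉ X → Exchange F W X z
  exchange-toward-X {W} FW W∈ fallback z∈W z∉X with ≡-dec Bool._≟_ W Y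
  ... | yes refl = fallback refl
  ... | no W≢Y   = ih FW FX (closer-to-X W∈ W≢Y) z∈W z∉X

  exchange-from-X : ∀ {W z} → F W → Between X Y W → (W ≡ Y → Exchange F X Y z) →
                    z ∈ X → z ∉ W → Exchange F X W z
  exchange-from-X {W} FW W∈ fallback z∈X z∉W with ≡-dec Bool._≟_ W Y
  ... | yes refl = fallback refl
  ... | no W≢Y   =
    ih FX FW (subst (_< ∣ X △ Y ∣) (cong ∣_∣ (△-comm W X)) (closer-to-X W∈ W≢Y)) z∈X z∉W

  module _ {x : Fin n} (x∈X : x ∈ X) (x∉Y : x ∉ Y) where

    X-half Y-half : Maybe (Fin n) → Set
    X-half y = F (X ⊖ just x ⊕ y)
    Y-half y = F (Y ⊕ just x ⊖ y)

    Y-half-returning-a : ∀ {a b y} → a ∈ X → a ∉ Y → a ≢ x → b ∈Diff∅ Y ∖ X → y ∈Diff∅ (Y ⊖ b) ∖ X →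
                         Exchange F X Y a → F (Y ⊕ just a ⊖ b ⊕ just x ⊖ y) →
                         Y-half y ⊎ Y-half b ⊎ F (Y ⊕ just a) × F (Y ⊖ b ⊕ just x ⊖ y)
    Y-half-returning-a {a} {b} {y} a∈X a∉Y a≢x b∈ y∈ a-exchange FW =
      conclude (exchange-toward-Y FW W-between (λ _ → a-exchange) a∈W a∉Y)
      where
      W : Subset n
      W = Y ⊕ just a ⊖ b ⊕ just x ⊖ y

      W-between : Between X Y W
      W-between = between-⊖ (between-⊕ (between-⊖ (between-⊕ between-ʳ (inj₁ (a∈X , a∉Y))) (inj₂ b∈))
                                        (inj₁ (x∈X , x∉Y)))
                            (inj₂ (∈Diff∅-⊖⁻ b y∈))

      a∈W : a ∈ W
      a∈W = ∈-⊖ (∈-⊕ {u = just x} (∈-⊖ (∈-⊕-self Y a) (∈Diff∅⇒≢ˡ b∈ a∉Y))) (∈Diff∅⇒≢ʳ y∈ a∈X)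

      W⊖a : W ⊖ just a ≡ Y ⊖ b ⊕ just x ⊖ y
      W⊖a = begin
        Y ⊕ just a ⊖ b ⊕ just x ⊖ y ⊖ just a ≡⟨ ⊖-comm (Y ⊕ just a ⊖ b ⊕ just x) y (just a) ⟩
        Y ⊕ just a ⊖ b ⊕ just x ⊖ just a ⊖ y ≡⟨ cong (_⊖ y) (⊕⊖-comm (Y ⊕ just a ⊖ b) (just x) x≢a) ⟩
        Y ⊕ just a ⊖ b ⊖ just a ⊕ just x ⊖ y ≡⟨ cong (λ T → T ⊕ just x ⊖ y) (⊖-comm (Y ⊕ just a) b (just a)) ⟩
        Y ⊕ just a ⊖ just a ⊖ b ⊕ just x ⊖ y ≡⟨ cong (λ T → T ⊖ b ⊕ just x ⊖ y) (∉⇒⊕⊖≡ a∉Y) ⟩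
        Y ⊖ b ⊕ just x ⊖ y                   ∎
        where
        open ≡-Reasoning
        x≢a = a≢x ∘ sym ∘ just-injective

      conclude : Exchange F W Y a → Y-half y ⊎ Y-half b ⊎ F (Y ⊕ just a) × F (Y ⊖ b ⊕ just x ⊖ y)
      conclude (nothing , _ , FW⊖a , FY⊕a) = inj₂ (inj₂ (FY⊕a , subst F W⊖a FW⊖a))
      conclude (just e , (e∈Y , e∉W) , FW⊖a⊕e , _) with ≡-dec-Maybe _≟_ b (just e)
      ... | yes b≡e = inj₁ (subst F (begin
        W ⊖ just a ⊕ just e              ≡⟨ cong (_⊕ just e) W⊖a ⟩
        Y ⊖ b ⊕ just x ⊖ y ⊕ just e      ≡⟨ cong (λ c → Y ⊖ c ⊕ just x ⊖ y ⊕ just e) b≡e ⟩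
        Y ⊖ just e ⊕ just x ⊖ y ⊕ just e ≡⟨ reinsert Y (just x) y e∈Y y≢e ⟩
        Y ⊕ just x ⊖ y                   ∎) FW⊖a⊕e)
        where
        open ≡-Reasoning
        y≢e = ∈Diff∅⇒≢ˡ y∈ (subst (λ c → e ∉ Y ⊖ c) (sym b≡e) (∉-⊖-self Y e))
      ... | no b≢e with ≡-dec-Maybe _≟_ y (just e)
      ...   | yes y≡e = inj₂ (inj₁ (subst F (begin
        W ⊖ just a ⊕ just e              ≡⟨ cong (_⊕ just e) W⊖a ⟩
        Y ⊖ b ⊕ just x ⊖ y ⊕ just e      ≡⟨ cong (λ c → Y ⊖ b ⊕ just x ⊖ c ⊕ just e) y≡e ⟩
        Y ⊖ b ⊕ just x ⊖ just e ⊕ just e ≡⟨ ∈⇒⊖⊕≡ (∈-⊕ {u = just x} (∈-⊖ e∈Y b≢e)) ⟩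
        Y ⊖ b ⊕ just x                   ≡⟨ ⊖⊕-comm Y b (∈Diff∅⇒≢ˡ b∈ x∉Y) ⟩
        Y ⊕ just x ⊖ b                   ∎) FW⊖a⊕e))
        where open ≡-Reasoning
      ...   | no y≢e = ⊥-elim (e∉W (∈-⊖ (∈-⊕ {u = just x} (∈-⊖ (∈-⊕ e∈Y) b≢e)) y≢e))

    X-half-returning-a : ∀ {a b y} → a ∈ X → a ∉ Y → a ≢ x → b ∈Diff∅ Y ∖ X → y ∈Diff∅ Y ∖ (X ⊕ b) →
                         Exchange F X Y a → F (X ⊖ just a ⊕ b ⊖ just x ⊕ y) →
                         X-half y ⊎ X-half b ⊎ F (X ⊖ just a) × F (X ⊕ b ⊖ just x ⊕ y)
    X-half-returning-a {a} {b} {y} a∈X a∉Y a≢x b∈ y∈ a-exchange FV =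
      conclude (exchange-from-X FV V-between (λ _ → a-exchange) a∈X a∉V)
      where
      V : Subset n
      V = X ⊖ just a ⊕ b ⊖ just x ⊕ y

      V-between : Between X Y V
      V-between = between-⊕ (between-⊖ (between-⊕ (between-⊖ between-ˡ (inj₁ (a∈X , a∉Y))) (inj₂ b∈))
                                        (inj₁ (x∈X , x∉Y)))
                            (inj₂ (∈Diff∅-⊕⁻ b y∈))

      a∉V : a ∉ V
      a∉V = ∉-⊕ (∉-⊖ {u = just x} (∉-⊕ (∉-⊖-self X a) (∈Diff∅⇒≢ˡ b∈ a∉Y))) (∈Diff∅⇒≢ˡ y∈ a∉Y)

      V⊕a : V ⊕ just a ≡ X ⊕ b ⊖ just x ⊕ y
      V⊕a = begin
        X ⊖ just a ⊕ b ⊖ just x ⊕ y ⊕ just a ≡⟨ ⊕-comm (X ⊖ just a ⊕ b ⊖ just x) y (just a) ⟩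
        X ⊖ just a ⊕ b ⊖ just x ⊕ just a ⊕ y ≡⟨ cong (_⊕ y) (⊖⊕-comm (X ⊖ just a ⊕ b) (just x) x≢a) ⟩
        X ⊖ just a ⊕ b ⊕ just a ⊖ just x ⊕ y ≡⟨ cong (λ T → T ⊖ just x ⊕ y) (⊕-comm (X ⊖ just a) b (just a)) ⟩
        X ⊖ just a ⊕ just a ⊕ b ⊖ just x ⊕ y ≡⟨ cong (λ T → T ⊕ b ⊖ just x ⊕ y) (∈⇒⊖⊕≡ a∈X) ⟩
        X ⊕ b ⊖ just x ⊕ y                   ∎
        where
        open ≡-Reasoning
        x≢a = a≢x ∘ sym ∘ just-injective

      conclude : Exchange F X V a → X-half y ⊎ X-half b ⊎ F (X ⊖ just a) × F (X ⊕ b ⊖ just x ⊕ y)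
      conclude (nothing , _ , FX⊖a , FV⊕a) = inj₂ (inj₂ (FX⊖a , subst F V⊕a FV⊕a))
      conclude (just e , (e∈V , e∉X) , _ , FV⊕a⊖e) with ≡-dec-Maybe _≟_ b (just e)
      ... | yes b≡e = inj₁ (subst F (begin
        V ⊕ just a ⊖ just e              ≡⟨ cong (_⊖ just e) V⊕a ⟩
        X ⊕ b ⊖ just x ⊕ y ⊖ just e      ≡⟨ cong (λ c → X ⊕ c ⊖ just x ⊕ y ⊖ just e) b≡e ⟩
        X ⊕ just e ⊖ just x ⊕ y ⊖ just e ≡⟨ redelete X (just x) y e∉X y≢e ⟩
        X ⊖ just x ⊕ y                   ∎) FV⊕a⊖e)
        where
        open ≡-Reasoning
        y≢e = ∈Diff∅⇒≢ʳ y∈ (subst (λ c → e ∈ X ⊕ c) (sym b≡e) (∈-⊕-self X e))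
      ... | no b≢e with ≡-dec-Maybe _≟_ y (just e)
      ...   | yes y≡e = inj₂ (inj₁ (subst F (begin
        V ⊕ just a ⊖ just e              ≡⟨ cong (_⊖ just e) V⊕a ⟩
        X ⊕ b ⊖ just x ⊕ y ⊖ just e      ≡⟨ cong (λ c → X ⊕ b ⊖ just x ⊕ c ⊖ just e) y≡e ⟩
        X ⊕ b ⊖ just x ⊕ just e ⊖ just e ≡⟨ ∉⇒⊕⊖≡ (∉-⊖ {u = just x} (∉-⊕ e∉X b≢e)) ⟩
        X ⊕ b ⊖ just x                   ≡⟨ ⊕⊖-comm X b (∈Diff∅⇒≢ʳ b∈ x∈X) ⟩
        X ⊖ just x ⊕ b                   ∎) FV⊕a⊖e))
        where open ≡-Reasoning
      ...   | no y≢e =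
        ⊥-elim (e∉X (∈-⊖⁻ {u = just a} (∈-⊕-≢⁻ (∈-⊖⁻ {u = just x} (∈-⊕-≢⁻ e∈V y≢e)) b≢e)))

    Y-half-returning-b : ∀ {b y} → b ∈ Y → b ∉ X → y ∈Diff∅ (Y ⊖ just b) ∖ X →
                         Exchange F Y X b → F (Y ⊖ just b ⊕ just x ⊖ y) → Y-half y ⊎ Y-half (just b)
    Y-half-returning-b {b} {y} b∈Y b∉X y∈ b-exchange FW =
      conclude (exchange-from-Y FW W-between (λ _ → b-exchange) b∈Y b∉W)
      where
      W : Subset n
      W = Y ⊖ just b ⊕ just x ⊖ y

      W-between : Between X Y W
      W-between = between-⊖ (between-⊕ (between-⊖ between-ʳ (inj₂ (b∈Y , b∉X))) (inj₁ (x∈X , x∉Y)))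
                            (inj₂ (∈Diff∅-⊖⁻ (just b) y∈))

      x≢b : just x ≢ just b
      x≢b = ∈Diff∅⇒≢ʳ {u = just x} (x∈X , x∉Y) b∈Y

      b∉W : b ∉ W
      b∉W = ∉-⊖ {u = y} (∉-⊕ (∉-⊖-self Y b) x≢b)

      conclude : Exchange F Y W b → Y-half y ⊎ Y-half (just b)
      conclude (nothing , _ , _ , FW⊕b) =
        inj₁ (subst F (reinsert Y (just x) y b∈Y (∈Diff∅⇒≢ˡ y∈ (∉-⊖-self Y b))) FW⊕b)
      conclude (just e , (e∈W , e∉Y) , FY⊖b⊕e , _) with ∈-⊕⁻ {u = just x} (∈-⊖⁻ {u = y} e∈W)
      ... | inj₁ refl   = inj₂ (subst F (⊖⊕-comm Y (just b) (x≢b ∘ sym)) FY⊖b⊕e)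
      ... | inj₂ e∈Y⊖b = ⊥-elim (e∉Y (∈-⊖⁻ {u = just b} e∈Y⊖b))

    X-half-returning-b : ∀ {b y} → b ∈ Y → b ∉ X → y ∈Diff∅ Y ∖ (X ⊕ just b) →
                         Exchange F Y X b → F (X ⊕ just b ⊖ just x ⊕ y) → X-half y ⊎ X-half (just b)
    X-half-returning-b {b} {y} b∈Y b∉X y∈ b-exchange FV =
      conclude (exchange-toward-X FV V-between (λ _ → b-exchange) b∈V b∉X)
      where
      V : Subset n
      V = X ⊕ just b ⊖ just x ⊕ y

      V-between : Between X Y V
      V-between = between-⊕ (between-⊖ (between-⊕ between-ˡ (inj₂ (b∈Y , b∉X))) (inj₁ (x∈X , x∉Y)))
                            (inj₂ (∈Diff∅-⊕⁻ (just b) y∈))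

      x≢b : just x ≢ just b
      x≢b = ∈Diff∅⇒≢ʳ {u = just x} (x∈X , x∉Y) b∈Y

      b∈V : b ∈ V
      b∈V = ∈-⊕ {u = y} (∈-⊖ (∈-⊕-self X b) x≢b)

      conclude : Exchange F V X b → X-half y ⊎ X-half (just b)
      conclude (nothing , _ , FV⊖b , _) =
        inj₁ (subst F (redelete X (just x) y b∉X (∈Diff∅⇒≢ʳ y∈ (∈-⊕-self X b))) FV⊖b)
      conclude (just e , (e∈X , e∉V) , _ , FX⊕b⊖e) with e ≟ x
      ... | yes refl = inj₂ (subst F (⊕⊖-comm X (just b) (x≢b ∘ sym)) FX⊕b⊖e)
      ... | no e≢x   = ⊥-elim (e∉V (∈-⊕ {u = y} (∈-⊖ (∈-⊕ e∈X) (e≢x ∘ sym ∘ just-injective))))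

    via-Y′ : ∀ {a b} → a ∈ X → a ∉ Y → a ≢ x → b ∈Diff∅ Y ∖ X →
             F (X ⊖ just a ⊕ b) → F (Y ⊕ just a ⊖ b) →
             Σ _ λ y → y ∈Diff∅ (Y ⊖ b) ∖ X × X-half y ×
               (Y-half y ⊎ Y-half b ⊎ F (Y ⊕ just a) × F (Y ⊖ b ⊕ just x ⊖ y))
    via-Y′ {a} {b} a∈X a∉Y a≢x b∈ FX′ FY′ =
      let y , y∈Y′∖X , X-half-y , FW =
            exchange-from-X FY′ Y′-between (⊥-elim ∘ ∈∉⇒≢ a∈Y′ a∉Y) x∈X x∉Y′
          y∈ = drop-a y∈Y′∖X
      in  y , y∈ , X-half-y , Y-half-returning-a a∈X a∉Y a≢x b∈ y∈ (b , b∈ , FX′ , FY′) FW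
      where
      Y′ : Subset n
      Y′ = Y ⊕ just a ⊖ b

      Y′-between : Between X Y Y′
      Y′-between = between-⊖ (between-⊕ between-ʳ (inj₁ (a∈X , a∉Y))) (inj₂ b∈)

      b≢a : b ≢ just a
      b≢a = ∈Diff∅⇒≢ˡ b∈ a∉Y

      a∈Y′ : a ∈ Y′
      a∈Y′ = ∈-⊖ (∈-⊕-self Y a) b≢a

      x∉Y′ : x ∉ Y′
      x∉Y′ = ∉-⊖ {u = b} (∉-⊕ x∉Y (a≢x ∘ just-injective))

      drop-a : ∀ {y} → y ∈Diff∅ Y′ ∖ X → y ∈Diff∅ (Y ⊖ b) ∖ X
      drop-a {nothing} _              = _
      drop-a {just e}  (e∈Y′ , e∉X) =
        ∈-⊕-≢⁻ (subst (e ∈_) (sym (⊖⊕-comm Y b b≢a)) e∈Y′) (∈Diff∅⇒≢ˡ {u = just a} (a∈X , a∉Y) e∉X) , e∉X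

    via-X′ : ∀ {a b} → a ∈ X → a ∉ Y → a ≢ x → b ∈Diff∅ Y ∖ X →
             F (X ⊖ just a ⊕ b) → F (Y ⊕ just a ⊖ b) →
             Σ _ λ y → y ∈Diff∅ Y ∖ (X ⊕ b) × Y-half y ×
               (X-half y ⊎ X-half b ⊎ F (X ⊖ just a) × F (X ⊕ b ⊖ just x ⊕ y))
    via-X′ {a} {b} a∈X a∉Y a≢x b∈ FX′ FY′ =
      let y , y∈Y∖X′ , FV , Y-half-y =
            exchange-toward-Y FX′ X′-between (⊥-elim ∘ ∈∉⇒≢ a∈X a∉X′ ∘ sym) x∈X′ x∉Y
          y∈ = drop-a y∈Y∖X′
      in  y , y∈ , Y-half-y , X-half-returning-a a∈X a∉Y a≢x b∈ y∈ (b , b∈ , FX′ , FY′) FV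
      where
      X′ : Subset n
      X′ = X ⊖ just a ⊕ b

      X′-between : Between X Y X′
      X′-between = between-⊕ (between-⊖ between-ˡ (inj₁ (a∈X , a∉Y))) (inj₂ b∈)

      b≢a : b ≢ just a
      b≢a = ∈Diff∅⇒≢ˡ b∈ a∉Y

      a∉X′ : a ∉ X′
      a∉X′ = ∉-⊕ (∉-⊖-self X a) b≢a

      x∈X′ : x ∈ X′
      x∈X′ = ∈-⊕ {u = b} (∈-⊖ x∈X (a≢x ∘ just-injective))

      drop-a : ∀ {y} → y ∈Diff∅ Y ∖ X′ → y ∈Diff∅ Y ∖ (X ⊕ b)
      drop-a {nothing} _              = _
      drop-a {just e}  (e∈Y , e∉X′) =
        e∈Y , λ e∈X⊕b →
          e∉X′ (subst (e ∈_) (⊕⊖-comm X b b≢a) (∈-⊖ e∈X⊕b (∈Diff∅⇒≢ʳ {u = just a} (a∈X , a∉Y) e∈Y)))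

    via-Y′-addition : ∀ {b} → b ∈ Y → b ∉ X → F (X ⊕ just b) → F (Y ⊖ just b) →
                      Σ _ λ y → y ∈Diff∅ (Y ⊖ just b) ∖ X × X-half y × (Y-half y ⊎ Y-half (just b))
    via-Y′-addition {b} b∈Y b∉X FX′ FY′ =
      let y , y∈ , X-half-y , FW =
            exchange-from-X FY′ (between-⊖ between-ʳ (inj₂ (b∈Y , b∉X)))
                            (⊥-elim ∘ ∈∉⇒≢ b∈Y (∉-⊖-self Y b) ∘ sym) x∈X (∉-⊖ {u = just b} x∉Y)
      in  y , y∈ , X-half-y , Y-half-returning-b b∈Y b∉X y∈ (nothing , _ , FY′ , FX′) FW

    via-X′-addition : ∀ {b} → b ∈ Y → b ∉ X → F (X ⊕ just b) → F (Y ⊖ just b) →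
                      Σ _ λ y → y ∈Diff∅ Y ∖ (X ⊕ just b) × Y-half y × (X-half y ⊎ X-half (just b))
    via-X′-addition {b} b∈Y b∉X FX′ FY′ =
      let y , y∈ , FV , Y-half-y =
            exchange-toward-Y FX′ (between-⊕ between-ˡ (inj₂ (b∈Y , b∉X)))
                              (⊥-elim ∘ ∈∉⇒≢ (∈-⊕-self X b) b∉X) (∈-⊕ {u = just b} x∈X) x∉Y
      in  y , y∈ , Y-half-y , X-half-returning-b b∈Y b∉X y∈ (nothing , _ , FY′ , FX′) FV

    exchange-after-removal : ∀ {a} → a ∈ X → a ∉ Y → a ≢ x → F (X ⊖ just a) → F (Y ⊕ just a) →
                             Exchange F X Y x
    exchange-after-removal a∈X a∉Y a≢x FX′ FY′
      with via-Y′ {b = nothing} a∈X a∉Y a≢x _ FX′ FY′ | via-X′ {b = nothing} a∈X a∉Y a≢x _ FX′ FY′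
    ... | y , y∈ , l , inj₁ r                  | _                                  = y , y∈ , l , r
    ... | y , y∈ , l , inj₂ (inj₂ (_ , r))     | _                                  = y , y∈ , l , r
    ... | _                                    | y , y∈ , r , inj₁ l                = y , y∈ , l , r
    ... | _                                    | y , y∈ , r , inj₂ (inj₂ (_ , l))   = y , y∈ , l , r
    ... | _ , _ , _ , inj₂ (inj₁ r)            | _ , _ , _ , inj₂ (inj₁ l)          = nothing , _ , l , r

    exchange-after-addition : ∀ {b} → b ∈ Y → b ∉ X → F (X ⊕ just b) → F (Y ⊖ just b) →
                              Exchange F X Y x
    exchange-after-addition {b} b∈Y b∉X FX′ FY′
      with via-Y′-addition b∈Y b∉X FX′ FY′ | via-X′-addition b∈Y b∉X FX′ FY′
    ... | y , y∈ , l , inj₁ r    | _                   = y , ∈Diff∅-⊖⁻ (just b) y∈ , l , r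
    ... | _                      | y , y∈ , r , inj₁ l = y , ∈Diff∅-⊕⁻ (just b) y∈ , l , r
    ... | _ , _ , _ , inj₂ r     | _ , _ , _ , inj₂ l  = just b , (b∈Y , b∉X) , l , r

    exchange-after-swap : ∀ {a b} → a ∈ X → a ∉ Y → a ≢ x → b ∈ Y → b ∉ X →
                          F (X ⊖ just a ⊕ just b) → F (Y ⊕ just a ⊖ just b) → Exchange F X Y x
    exchange-after-swap {b = b} a∈X a∉Y a≢x b∈Y b∉X FX′ FY′
      with via-Y′ a∈X a∉Y a≢x (b∈Y , b∉X) FX′ FY′ | via-X′ a∈X a∉Y a≢x (b∈Y , b∉X) FX′ FY′
    ... | y , y∈ , l , inj₁ r             | _                   = y , ∈Diff∅-⊖⁻ (just b) y∈ , l , r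
    ... | _                               | y , y∈ , r , inj₁ l = y , ∈Diff∅-⊕⁻ (just b) y∈ , l , r
    ... | _ , _ , _ , inj₂ (inj₁ r)       | _ , _ , _ , inj₂ (inj₁ l) = just b , (b∈Y , b∉X) , l , r
    ... | _ , _ , _ , inj₂ (inj₁ r)       | y , y∈ , r′ , inj₂ (inj₂ (_ , FV))
      with X-half-returning-b b∈Y b∉X y∈ (reverse-exchange {F = F} a∈X a∉Y b∈Y FX′ FY′) FV
    ...   | inj₁ l = y , ∈Diff∅-⊕⁻ (just b) y∈ , l , r′
    ...   | inj₂ l = just b , (b∈Y , b∉X) , l , r
    exchange-after-swap {b = b} a∈X a∉Y a≢x b∈Y b∉X FX′ FY′
      | y , y∈ , l′ , inj₂ (inj₂ (_ , FW)) | _ , _ , _ , inj₂ (inj₁ l)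
      with Y-half-returning-b b∈Y b∉X y∈ (reverse-exchange {F = F} a∈X a∉Y b∈Y FX′ FY′) FW
    ...   | inj₁ r = y , ∈Diff∅-⊖⁻ (just b) y∈ , l′ , r
    ...   | inj₂ r = just b , (b∈Y , b∉X) , l , r
    exchange-after-swap a∈X a∉Y a≢x b∈Y b∉X FX′ FY′
      | _ , _ , _ , inj₂ (inj₂ (FY⊕a , _)) | _ , _ , _ , inj₂ (inj₂ (FX⊖a , _)) =
      exchange-after-removal a∈X a∉Y a≢x FX⊖a FY⊕a

    exchange-step : SimultaneousExchange F → Exchange F X Y x
    exchange-step simultaneous with simultaneous X Y FX FY (∈∉⇒≢ x∈X x∉Y)
    ... | nothing , nothing , a≢b , _ = ⊥-elim (a≢b refl)
    ... | nothing , just b , _ , _ , (b∈Y , b∉X) , FX′ , FY′ = exchange-after-addition b∈Y b∉X FX′ FY′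
    ... | just a , nothing , _ , (a∈X , a∉Y) , _ , FX′ , FY′ with a ≟ x
    ...   | yes refl = nothing , _ , FX′ , FY′
    ...   | no a≢x   = exchange-after-removal a∈X a∉Y a≢x FX′ FY′
    exchange-step simultaneous
      | just a , just b , _ , (a∈X , a∉Y) , (b∈Y , b∉X) , FX′ , FY′ with a ≟ x
    ...   | yes refl = just b , (b∈Y , b∉X) , FX′ , FY′
    ...   | no a≢x   = exchange-after-swap a∈X a∉Y a≢x b∈Y b∉X FX′ FY′

exchange-below : ∀ {F : Subset n → Set} → SimultaneousExchange F → ∀ d {X Y} → ∣ X △ Y ∣ < d →
                 F X → F Y → ∀ {x} → x ∈ X → x ∉ Y → Exchange F X Y x
exchange-below simultaneous (suc d) X△Y<1+d FX FY x∈X x∉Y =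
  ExchangeStep.exchange-step FX FY
    (λ FP FQ P△Q<X△Y → exchange-below simultaneous d (<-≤-trans P△Q<X△Y (≤-pred X△Y<1+d)) FP FQ)
    x∈X x∉Y simultaneous

†⇒M♮ : ∀ {F : Subset n → Set} → (∃ λ X → F X) → SimultaneousExchange F → IsMNatConvex F
†⇒M♮ nonempty simultaneous =
  nonempty , λ X Y FX FY x x∈X x∉Y → exchange-below simultaneous _ (n<1+n _) FX FY x∈X x∉Y

M♮⇒† : ∀ {F : Subset n → Set} → IsMNatConvex F → SimultaneousExchange F
M♮⇒† {F = F} (_ , exchange) X X′ FX FX′ X≢X′ with ≢⇒∃∈△ X≢X′
... | i , i∈X△X′ with ∈△⁻ X X′ i∈X△X′
...   | inj₁ (i∈X , i∉X′) =
  let y , y∈ , FX₁ , FX′₁ = exchange X X′ FX FX′ i i∈X i∉X′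
  in  just i , y , ∈Diff∅⇒≢ˡ y∈ i∉X′ ∘ sym , (i∈X , i∉X′) , y∈ , FX₁ , FX′₁
...   | inj₂ (i∈X′ , i∉X) =
  let y , y∈ , FX′₁ , FX₁ = exchange X′ X FX′ FX i i∈X′ i∉X
      y≢i = ∈Diff∅⇒≢ˡ y∈ i∉X
  in  y , just i , y≢i , y∈ , (i∈X′ , i∉X) ,
      subst F (sym (⊖⊕-comm X y y≢i)) FX₁ , subst F (sym (⊕⊖-comm X′ y y≢i)) FX′₁

proposition2p1 : (n : ℕ) → (𝓕 : Subset (suc n) → Set) → (∃ λ X → 𝓕 X) →
    (SimultaneousExchange 𝓕 ⇔ IsMNatConvex 𝓕)
proposition2p1 _ 𝓕 nonempty = mk⇔ (†⇒M♮ nonempty) M♮⇒†
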